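{- Let $H$ be a connected graph of order $n_2$. Let $G$ be a nontrivial connected graph of order $n_1$ having $t_1$ true twin equivalence classes. Then $\dim(G\boxtimes H)\ge n_2(n_1-t_1)$.
   Context: All graphs are simple and connected; $d_G$ is the shortest-path distance. A set $S\subseteq V(G)$ is a metric generator for $G$ if for every two distinct vertices $x,y$ there is $s\in S$ with $d_G(s,x)\ne d_G(s,y)$; $\dim(G)$ is the minimum cardinality of a metric generator. The strong product $G\boxtimes H$ has vertex set $V(G)\times V(H)$, with $(a,b)$ and $(c,d)$ adjacent iff ($a=c$ and $bd\in E(H)$) or ($b=d$ and $ac\in E(G)$) or ($ac\in E(G)$ and $bd\in E(H)$). $N_G[v]$ is the closed neighborhood of $v$; the true twin equivalence classes of $G$ are the classes of the relation $x\sim y\iff N_G[x]=N_G[y]$. Nontrivial means at least two vertices. -}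

module Defs where

open import Data.Nat using (ℕ; zero; suc; _*_; _<_)
import Data.Nat
import Data.Bool
import Data.Fin.Properties
open import Data.Bool using (Bool; true; false; _∧_; _∨_; not)
open import Data.Fin using (Fin; toℕ; remQuot; _≟_)
open import Data.Fin.Subset using (Subset; _∈_; ∣_∣)
open import Data.Fin.Properties using (any?)
open import Data.Vec using (tabulate)
open import Data.Product using (Σ; ∃; _×_; _,_; proj₁; proj₂)
open import Relation.Nullary using (¬_; Dec)
open import Relation.Nullary.Decidable using (⌊_⌋; _×-dec_)
open import Relation.Binary.PropositionalEquality using (_≡_; _≢_)

record Graph (n : ℕ) : Set where
  field
    adj : Fin n → Fin n → Bool
open Graph public

IsSimple : ∀ {n} → Graph n → Set
IsSimple G = (∀ x → adj G x x ≡ false) × (∀ x y → adj G x y ≡ adj G y x)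

data Walk {n : ℕ} (G : Graph n) : Fin n → Fin n → ℕ → Set where
  here : ∀ {u} → Walk G u u 0
  step : ∀ {u w v k} → adj G u w ≡ true → Walk G w v k → Walk G u v (suc k)

Connected : ∀ {n} → Graph n → Set
Connected G = ∀ u v → ∃ λ k → Walk G u v k

IsDist : ∀ {n} → Graph n → Fin n → Fin n → ℕ → Set
IsDist G u v k = Walk G u v k × (∀ j → j < k → ¬ Walk G u v j)

Resolves : ∀ {n} → Graph n → Fin n → Fin n → Fin n → Set
Resolves G s x y = ∀ k l → IsDist G s x k → IsDist G s y l → k ≢ l

IsMetricGenerator : ∀ {n} → Graph n → Subset n → Set
IsMetricGenerator {n} G S =
  ∀ (x y : Fin n) → x ≢ y → ∃ λ s → s ∈ S × Resolves G s x y

DimAtLeast : ∀ {n} → Graph n → ℕ → Set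
DimAtLeast {n} G m = ∀ (S : Subset n) → IsMetricGenerator G S → m Data.Nat.≤ ∣ S ∣

inClosedNbhd : ∀ {n} → Graph n → Fin n → Fin n → Bool
inClosedNbhd G x z = ⌊ x ≟ z ⌋ ∨ adj G x z

TrueTwins : ∀ {n} → Graph n → Fin n → Fin n → Set
TrueTwins G x y = ∀ z → inClosedNbhd G x z ≡ inClosedNbhd G y z

-- Number of true twin equivalence classes: count the vertices that are the
-- smallest (w.r.t. the order on Fin n) element of their class.
isClassRep : ∀ {n} → Graph n → Fin n → Bool
isClassRep {n} G x =
  not ⌊ any? (λ y → (toℕ y Data.Nat.<? toℕ x) ×-dec
                     Data.Fin.Properties.all?
                       (λ z → Data.Bool._≟_ (inClosedNbhd G y z) (inClosedNbhd G x z))) ⌋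

trueTwinClasses : ∀ {n} → Graph n → ℕ
trueTwinClasses G = ∣ tabulate (isClassRep G) ∣

-- Strong product on Fin (n₁ * n₂), vertex k corresponding to remQuot n₂ k.
_⊠_ : ∀ {n₁ n₂} → Graph n₁ → Graph n₂ → Graph (n₁ * n₂)
adj (_⊠_ {n₁} {n₂} G H) i j with remQuot {n₁} n₂ i | remQuot {n₁} n₂ j
... | (a , b) | (c , d) =
  (⌊ a ≟ c ⌋ ∧ adj H b d) ∨ (⌊ b ≟ d ⌋ ∧ adj G a c) ∨ (adj G a c ∧ adj H b d)

-- True twins x ≠ y of a graph have the same distance to every third vertex,
-- so every metric generator contains one of them.  If x and y are true twins
-- of G, then (x, b) and (y, b) are true twins of G ⊠ H, because closed
-- neighbourhoods of the strong product are products of closed neighbourhoods.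
-- Hence in every fibre G × {b} a metric generator of G ⊠ H misses at most one
-- vertex of each true twin class of G, i.e. it has at least n₁ − t₁ vertices
-- there, and summing over the n₂ fibres gives the bound.
module Submission where

open import Defs
open import Data.Nat using (ℕ; zero; suc; _*_; _∸_; _≤_; _<_; z≤n; s≤s; _+_)
open import Data.Nat.Properties using (≤-trans; ≤-antisym; ≮⇒≥; anyUpTo?)
open import Data.Nat.Induction using (<-rec)
open import Data.Bool using (Bool; true; false; _∧_; _∨_; not) renaming (_≟_ to _≟ᵇ_)
open import Data.Bool.Properties using (∨-zeroʳ; ¬-not)
open import Data.Bool.Solver using (module ∨-∧-Solver)
open import Data.Fin using (Fin; zero; suc; toℕ; combine; remQuot; _≟_)
open import Data.Fin.Properties using (suc-injective; remQuot-combine; combine-remQuot;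
  combine-injective; combine-injectiveˡ; combine-injectiveʳ; any?)
open import Data.Fin.Induction using () renaming (<-wellFounded to Fin-<-wellFounded)
open import Data.Fin.Subset using (Subset; _∈_; _∉_; ∣_∣; _-_; ∁)
open import Data.Fin.Subset.Properties using (_∈?_; x∈p⇒∣p-x∣<∣p∣; x∈p∧x≢y⇒x∈p-y;
  x∈∁p⇒x∉p; ∣∁p∣≡n∸∣p∣)
open import Data.Vec using (_∷_; here; there; tabulate)
open import Data.Vec.Properties using (lookup⇒[]=; lookup∘tabulate)
open import Data.Product using (∃; _×_; _,_; proj₁; proj₂; uncurry)
open import Data.Empty using (⊥-elim)
open import Function using (_∘_)
open import Function.Definitions using (Injective)
open import Induction.WellFounded as WF using ()
open import Level using (Level; 0ℓ)
open import Relation.Nullary using (¬_; Dec; yes; no; contradiction)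
open import Relation.Nullary.Decidable using (⌊_⌋; _×-dec_)
open import Relation.Unary using (Pred; Decidable)
open import Relation.Binary.PropositionalEquality
  using (_≡_; _≢_; refl; sym; trans; cong; cong₂; subst; subst₂; ≡-≟-identity; ≢-≟-identity)
open Relation.Binary.PropositionalEquality.≡-Reasoning

private
  variable
    n m n₁ n₂ : ℕ

minimal-witness : ∀ {ℓ} {P : Pred ℕ ℓ} → Decidable P →
  ∀ {k} → P k → ∃ λ d → P d × (∀ j → j < d → ¬ P j)
minimal-witness {P = P} P? {k} = <-rec (λ k → P k → ∃ λ d → P d × (∀ j → j < d → ¬ P j)) go k
  where
  go : ∀ k → (∀ {j} → j < k → P j → ∃ λ d → P d × (∀ j → j < d → ¬ P j)) →
       P k → ∃ λ d → P d × (∀ j → j < d → ¬ P j)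
  go k rec Pk with anyUpTo? P? k
  ... | yes (j , j<k , Pj) = rec j<k Pj
  ... | no none-below      = k , Pk , λ j j<k Pj → none-below (j , j<k , Pj)

⌊≟⌋-refl : (a : Fin n) → ⌊ a ≟ a ⌋ ≡ true
⌊≟⌋-refl a = cong ⌊_⌋ (≡-≟-identity _≟_ refl)

⌊≟⌋-sym : (a c : Fin n) → ⌊ a ≟ c ⌋ ≡ ⌊ c ≟ a ⌋
⌊≟⌋-sym a c with a ≟ c | c ≟ a
... | yes _   | yes _   = refl
... | no _    | no _    = refl
... | yes a≡c | no c≢a  = contradiction (sym a≡c) c≢a
... | no a≢c  | yes c≡a = contradiction (sym c≡a) a≢c

⌊combine≟combine⌋ : (a c : Fin n₁) (b d : Fin n₂) →
  ⌊ combine a b ≟ combine c d ⌋ ≡ ⌊ a ≟ c ⌋ ∧ ⌊ b ≟ d ⌋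
⌊combine≟combine⌋ a c b d with a ≟ c | b ≟ d
... | yes refl | yes refl = ⌊≟⌋-refl (combine a b)
... | no a≢c   | _        = cong ⌊_⌋ (≢-≟-identity _≟_ (a≢c ∘ combine-injectiveˡ a b c d))
... | yes _    | no b≢d   = cong ⌊_⌋ (≢-≟-identity _≟_ (b≢d ∘ combine-injectiveʳ a b c d))

Undirected : Graph n → Set
Undirected K = ∀ x y → adj K x y ≡ adj K y x

_++ʷ_ : ∀ {K : Graph n} {u v w j k} → Walk K u v j → Walk K v w k → Walk K u w (j + k)
here       ++ʷ W′ = W′
step a W   ++ʷ W′ = step a (W ++ʷ W′)

module _ (K : Graph n) where

  walk? : ∀ u v k → Dec (Walk K u v k)
  walk? u v zero with u ≟ v
  ... | yes refl = yes here
  ... | no u≢v   = no λ { here → u≢v refl }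
  walk? u v (suc k) with any? (λ w → (adj K u w ≟ᵇ true) ×-dec walk? w v k)
  ... | yes (w , a , W) = yes (step a W)
  ... | no  none        = no λ { (step {w = w} a W) → none (w , a , W) }

  distance : Connected K → ∀ u v → ∃ (IsDist K u v)
  distance connected u v = minimal-witness (walk? u v) (proj₂ (connected u v))

  twins-sym : ∀ {u v} → TrueTwins K u v → TrueTwins K v u
  twins-sym tw z = sym (tw z)

  twins-trans : ∀ {x y z} → TrueTwins K x y → TrueTwins K y z → TrueTwins K x z
  twins-trans x~y y~z w = trans (x~y w) (y~z w)

  inClosedNbhd-≢ : ∀ {x z} → x ≢ z → inClosedNbhd K x z ≡ adj K x z
  inClosedNbhd-≢ {x} {z} x≢z = cong (_∨ adj K x z) (cong ⌊_⌋ (≢-≟-identity _≟_ x≢z))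

  twin-adj : Undirected K → ∀ {u v s} → TrueTwins K u v → s ≢ v →
    adj K s u ≡ true → adj K s v ≡ true
  twin-adj undirected {u} {v} {s} tw s≢v s~u = begin
    adj K s v          ≡⟨ undirected s v ⟩
    adj K v s          ≡⟨ inClosedNbhd-≢ (s≢v ∘ sym) ⟨
    inClosedNbhd K v s ≡⟨ tw s ⟨
    ⌊ u ≟ s ⌋ ∨ adj K u s ≡⟨ cong (⌊ u ≟ s ⌋ ∨_) (trans (undirected u s) s~u) ⟩
    ⌊ u ≟ s ⌋ ∨ true   ≡⟨ ∨-zeroʳ _ ⟩
    true               ∎

  module _ (undirected : Undirected K) {u v : Fin n} (tw : TrueTwins K u v) where

    -- The walk is cut at its first visit to u or v; a visit to u is replaced
    -- by a step to v, which is adjacent to the previous vertex.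
    walk-to-twin : ∀ {s k} → Walk K s u k → s ≢ u → s ≢ v → ∃ λ j → j ≤ k × Walk K s v j
    walk-to-twin here s≢u _ = contradiction refl s≢u
    walk-to-twin (step {w = w} s~w W) s≢u s≢v with w ≟ u | w ≟ v
    ... | yes refl | _        = 1 , s≤s z≤n , step (twin-adj undirected tw s≢v s~w) here
    ... | no _     | yes refl = 1 , s≤s z≤n , step s~w here
    ... | no w≢u   | no w≢v   with walk-to-twin W w≢u w≢v
    ...   | j , j≤k , W′ = suc j , s≤s j≤k , step s~w W′

    twin-dist-≤ : ∀ {s k l} → IsDist K s u k → IsDist K s v l → s ≢ u → s ≢ v → l ≤ k
    twin-dist-≤ (Wk , _) (_ , shortest) s≢u s≢v with walk-to-twin Wk s≢u s≢v
    ... | j , j≤k , Wj = ≤-trans (≮⇒≥ λ j<l → shortest j j<l Wj) j≤k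

  twins-equidistant : Undirected K → ∀ {u v s k l} → TrueTwins K u v →
    IsDist K s u k → IsDist K s v l → s ≢ u → s ≢ v → k ≡ l
  twins-equidistant undirected tw du dv s≢u s≢v =
    ≤-antisym (twin-dist-≤ undirected (twins-sym tw) dv du s≢v s≢u)
              (twin-dist-≤ undirected tw du dv s≢u s≢v)

  twin-∈-generator : Undirected K → Connected K → ∀ {S u v} → IsMetricGenerator K S →
    u ≢ v → TrueTwins K u v → u ∉ S → v ∈ S
  twin-∈-generator undirected connected {S} {u} {v} generator u≢v tw u∉S with v ∈? S
  ... | yes v∈S = v∈S
  ... | no  v∉S with generator u v u≢v
  ...   | s , s∈S , resolves with distance connected s u | distance connected s v
  ...     | k , du | l , dv =
    ⊥-elim (resolves k l du dv (twins-equidistant undirected tw du dv s≢u s≢v))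
    where
    s≢u : s ≢ u
    s≢u refl = u∉S s∈S
    s≢v : s ≢ v
    s≢v refl = v∉S s∈S

strongAdj : Graph n₁ → Graph n₂ → Fin n₁ → Fin n₂ → Fin n₁ → Fin n₂ → Bool
strongAdj G H a b c d =
  (⌊ a ≟ c ⌋ ∧ adj H b d) ∨ (⌊ b ≟ d ⌋ ∧ adj G a c) ∨ (adj G a c ∧ adj H b d)

module _ (G : Graph n₁) (H : Graph n₂) where

  adj-⊠-combine : ∀ a b c d → adj (G ⊠ H) (combine a b) (combine c d) ≡ strongAdj G H a b c d
  adj-⊠-combine a b c d =
    cong₂ (λ (p q : Fin n₁ × Fin n₂) → strongAdj G H (proj₁ p) (proj₂ p) (proj₁ q) (proj₂ q))
      (remQuot-combine a b) (remQuot-combine c d)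

  ⊠-undirected : Undirected G → Undirected H → Undirected (G ⊠ H)
  ⊠-undirected symG symH i j = strongAdj-sym (remQuot {n₁} n₂ i) (remQuot {n₁} n₂ j)
    where
    strongAdj-sym : ∀ ((a , b) (c , d) : Fin n₁ × Fin n₂) → strongAdj G H a b c d ≡ strongAdj G H c d a b
    strongAdj-sym (a , b) (c , d)
      rewrite ⌊≟⌋-sym a c | ⌊≟⌋-sym b d | symG a c | symH b d = refl

  closedNbhd-⊠ : ∀ a b c d →
    inClosedNbhd (G ⊠ H) (combine a b) (combine c d) ≡ inClosedNbhd G a c ∧ inClosedNbhd H b d
  closedNbhd-⊠ a b c d = begin
    ⌊ combine a b ≟ combine c d ⌋ ∨ adj (G ⊠ H) (combine a b) (combine c d)
      ≡⟨ cong₂ _∨_ (⌊combine≟combine⌋ a c b d) (adj-⊠-combine a b c d) ⟩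
    (⌊ a ≟ c ⌋ ∧ ⌊ b ≟ d ⌋) ∨ strongAdj G H a b c d
      ≡⟨ expand ⌊ a ≟ c ⌋ ⌊ b ≟ d ⌋ (adj G a c) (adj H b d) ⟩
    (⌊ a ≟ c ⌋ ∨ adj G a c) ∧ (⌊ b ≟ d ⌋ ∨ adj H b d) ∎
    where
    open ∨-∧-Solver
    expand : ∀ p q g h → (p ∧ q) ∨ ((p ∧ h) ∨ ((q ∧ g) ∨ (g ∧ h))) ≡ (p ∨ g) ∧ (q ∨ h)
    expand = solve 4 (λ p q g h → (p :* q) :+ ((p :* h) :+ ((q :* g) :+ (g :* h)))
                                  := (p :+ g) :* (q :+ h)) refl

  ⊠-trueTwins : ∀ {x y} b → TrueTwins G x y → TrueTwins (G ⊠ H) (combine x b) (combine y b)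
  ⊠-trueTwins {x} {y} b tw z =
    subst (λ z → inClosedNbhd (G ⊠ H) (combine x b) z ≡ inClosedNbhd (G ⊠ H) (combine y b) z)
      (combine-remQuot {n₁} n₂ z) (twins-at (remQuot {n₁} n₂ z))
    where
    twins-at : ∀ ((c , d) : Fin n₁ × Fin n₂) →
      inClosedNbhd (G ⊠ H) (combine x b) (combine c d) ≡ inClosedNbhd (G ⊠ H) (combine y b) (combine c d)
    twins-at (c , d) = begin
      inClosedNbhd (G ⊠ H) (combine x b) (combine c d) ≡⟨ closedNbhd-⊠ x b c d ⟩
      inClosedNbhd G x c ∧ inClosedNbhd H b d           ≡⟨ cong (_∧ inClosedNbhd H b d) (tw c) ⟩
      inClosedNbhd G y c ∧ inClosedNbhd H b d           ≡⟨ closedNbhd-⊠ y b c d ⟨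
      inClosedNbhd (G ⊠ H) (combine y b) (combine c d) ∎

  walk-⊠ˡ : ∀ {a c k} (b : Fin n₂) → Walk G a c k → Walk (G ⊠ H) (combine a b) (combine c b) k
  walk-⊠ˡ b here = here
  walk-⊠ˡ {a} b (step {w = w} a~w W) = step (trans (adj-⊠-combine a b w b) G-step) (walk-⊠ˡ b W)
    where
    G-step : strongAdj G H a b w b ≡ true
    G-step rewrite a~w | ⌊≟⌋-refl b = ∨-zeroʳ _

  walk-⊠ʳ : ∀ {b d k} (a : Fin n₁) → Walk H b d k → Walk (G ⊠ H) (combine a b) (combine a d) k
  walk-⊠ʳ a here = here
  walk-⊠ʳ {b} a (step {w = w} b~w W) = step (trans (adj-⊠-combine a b a w) H-step) (walk-⊠ʳ a W)
    where
    H-step : strongAdj G H a b a w ≡ true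
    H-step rewrite b~w | ⌊≟⌋-refl a = refl

  ⊠-connected : Connected G → Connected H → Connected (G ⊠ H)
  ⊠-connected connG connH i j =
    subst₂ (λ i j → ∃ (Walk (G ⊠ H) i j)) (combine-remQuot {n₁} n₂ i) (combine-remQuot {n₁} n₂ j)
      (connect (remQuot {n₁} n₂ i) (remQuot {n₁} n₂ j))
    where
    connect : ∀ ((a , b) (c , d) : Fin n₁ × Fin n₂) → ∃ (Walk (G ⊠ H) (combine a b) (combine c d))
    connect (a , b) (c , d) =
      _ , (walk-⊠ˡ b (proj₂ (connG a c)) ++ʷ walk-⊠ʳ c (proj₂ (connH b d)))

injective⇒≤∣p∣ : ∀ (B : Subset n) (f : Fin m → Fin n) → Injective _≡_ _≡_ f →
  (∀ i → f i ∈ B) → m ≤ ∣ B ∣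
injective⇒≤∣p∣ {m = zero}  B f _ _ = z≤n
injective⇒≤∣p∣ {m = suc m} B f f-inj f∈B =
  ≤-trans (s≤s (injective⇒≤∣p∣ (B - f zero) (f ∘ suc) (suc-injective ∘ f-inj) f∘suc∈))
          (x∈p⇒∣p-x∣<∣p∣ (f∈B zero))
  where
  f∘suc∈ : ∀ i → f (suc i) ∈ B - f zero
  f∘suc∈ i = x∈p∧x≢y⇒x∈p-y (f∈B (suc i)) (λ fi≡f0 → case (f-inj (sym fi≡f0)))
    where
    case : zero ≢ suc i
    case ()

element : (p : Subset n) → Fin ∣ p ∣ → Fin n
element (true  ∷ p) zero    = zero
element (true  ∷ p) (suc i) = suc (element p i)
element (false ∷ p) i       = suc (element p i)

element-∈ : (p : Subset n) (i : Fin ∣ p ∣) → element p i ∈ p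
element-∈ (true  ∷ p) zero    = here
element-∈ (true  ∷ p) (suc i) = there (element-∈ p i)
element-∈ (false ∷ p) i       = there (element-∈ p i)

element-injective : (p : Subset n) → Injective _≡_ _≡_ (element p)
element-injective (true  ∷ p) {zero}  {zero}  _  = refl
element-injective (true  ∷ p) {suc i} {suc j} eq = cong suc (element-injective p (suc-injective eq))
element-injective (false ∷ p) eq                 = element-injective p (suc-injective eq)

fibrewise-injections⇒≤ : ∀ (R : Subset m) (S : Subset (n₁ * n₂)) (φ : Fin n₂ → Fin m → Fin n₁) →
  (∀ b {x y} → x ∈ R → y ∈ R → φ b x ≡ φ b y → x ≡ y) →
  (∀ b {x} → x ∈ R → combine (φ b x) b ∈ S) →
  n₂ * ∣ R ∣ ≤ ∣ S ∣
fibrewise-injections⇒≤ {n₁ = n₁} {n₂ = n₂} R S φ φ-inj φ∈S = injective⇒≤∣p∣ S f f-inj f∈S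
  where
  f : Fin (n₂ * ∣ R ∣) → Fin (n₁ * n₂)
  f k = let (b , i) = remQuot {n₂} ∣ R ∣ k in combine (φ b (element R i)) b

  f∈S : ∀ k → f k ∈ S
  f∈S k = φ∈S (proj₁ (remQuot {n₂} ∣ R ∣ k)) (element-∈ R _)

  f-inj : Injective _≡_ _≡_ f
  f-inj {k} {k′} fk≡fk′ = begin
    k                                       ≡⟨ combine-remQuot {n₂} ∣ R ∣ k ⟨
    uncurry combine (remQuot {n₂} ∣ R ∣ k)  ≡⟨ cong₂ combine b≡b′ i≡i′ ⟩
    uncurry combine (remQuot {n₂} ∣ R ∣ k′) ≡⟨ combine-remQuot {n₂} ∣ R ∣ k′ ⟩
    k′                                      ∎
    where
    b b′ : Fin n₂
    b = proj₁ (remQuot {n₂} ∣ R ∣ k)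
    b′ = proj₁ (remQuot {n₂} ∣ R ∣ k′)
    i i′ : Fin ∣ R ∣
    i = proj₂ (remQuot {n₂} ∣ R ∣ k)
    i′ = proj₂ (remQuot {n₂} ∣ R ∣ k′)
    φ≡φ×b≡b′ : φ b (element R i) ≡ φ b′ (element R i′) × b ≡ b′
    φ≡φ×b≡b′ = combine-injective (φ b (element R i)) b (φ b′ (element R i′)) b′ fk≡fk′
    b≡b′ : b ≡ b′
    b≡b′ = proj₂ φ≡φ×b≡b′
    i≡i′ : i ≡ i′
    i≡i′ = element-injective R (φ-inj b′ (element-∈ R i) (element-∈ R i′)
             (subst (λ c → φ c (element R i) ≡ φ b′ (element R i′)) b≡b′ (proj₁ φ≡φ×b≡b′)))

module _ (G : Graph n) where

  classReps : Subset n
  classReps = tabulate (isClassRep G)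

  nonReps : Subset n
  nonReps = ∁ classReps

  ∣nonReps∣ : ∣ nonReps ∣ ≡ n ∸ trueTwinClasses G
  ∣nonReps∣ = ∣∁p∣≡n∸∣p∣ classReps

  ∈-classReps : ∀ {x} → isClassRep G x ≡ true → x ∈ classReps
  ∈-classReps {x} isRep = lookup⇒[]= x classReps (trans (lookup∘tabulate (isClassRep G) x) isRep)

  smaller-twin : ∀ {x} → x ∉ classReps → ∃ λ y → toℕ y < toℕ x × TrueTwins G y x
  smaller-twin x∉ = witness _ (¬-not (x∉ ∘ ∈-classReps))
    where
    witness : ∀ {A : Set} (A? : Dec A) → not ⌊ A? ⌋ ≡ false → A
    witness (yes a) _ = a

  classRep : ∀ x → ∃ λ y → y ∈ classReps × TrueTwins G y x
  classRep = WF.All.wfRec Fin-<-wellFounded 0ℓ (λ x → ∃ λ y → y ∈ classReps × TrueTwins G y x) go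
    where
    go : ∀ x → (∀ {y} → toℕ y < toℕ x → ∃ λ z → z ∈ classReps × TrueTwins G z y) →
         ∃ λ y → y ∈ classReps × TrueTwins G y x
    go x rec with x ∈? classReps
    ... | yes x∈ = x , x∈ , λ _ → refl
    ... | no  x∉ with smaller-twin x∉
    ...   | y , y<x , y~x with rec y<x
    ...     | z , z∈ , z~y = z , z∈ , twins-trans G z~y y~x

  rep : Fin n → Fin n
  rep x = proj₁ (classRep x)

  rep~ : ∀ x → TrueTwins G (rep x) x
  rep~ x = proj₂ (proj₂ (classRep x))

  nonRep≢rep : ∀ {x} y → x ∈ nonReps → x ≢ rep y
  nonRep≢rep y x∈ x≡rep = x∈∁p⇒x∉p x∈ (subst (_∈ classReps) (sym x≡rep) (proj₁ (proj₂ (classRep y))))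

  -- Two non-representatives missing from P are never twins, so replacing them
  -- by their class representatives keeps select injective.
  module _ {ℓ : Level} {P : Pred (Fin n) ℓ} (P? : Decidable P)
           (twin-∈ : ∀ {x y} → x ≢ y → TrueTwins G x y → ¬ P x → P y) where

    select : Fin n → Fin n
    select x with P? x
    ... | yes _ = x
    ... | no  _ = rep x

    select-∈ : ∀ {x} → x ∈ nonReps → P (select x)
    select-∈ {x} x∈ with P? x
    ... | yes Px = Px
    ... | no ¬Px = twin-∈ (nonRep≢rep x x∈) (twins-sym G (rep~ x)) ¬Px

    select-injective : ∀ {x y} → x ∈ nonReps → y ∈ nonReps → select x ≡ select y → x ≡ y
    select-injective {x} {y} x∈ y∈ eq with P? x | P? y
    ... | yes _  | yes _  = eq
    ... | yes _  | no _   = contradiction eq (nonRep≢rep y x∈)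
    ... | no _   | yes _  = contradiction (sym eq) (nonRep≢rep x y∈)
    ... | no ¬Px | no ¬Py with x ≟ y
    ...   | yes x≡y = x≡y
    ...   | no  x≢y = contradiction (twin-∈ x≢y x~y ¬Px) ¬Py
      where
      x~y : TrueTwins G x y
      x~y = twins-trans G (twins-sym G (rep~ x)) (subst (λ r → TrueTwins G r y) (sym eq) (rep~ y))

corollary2 : ∀ {n₁ n₂ : ℕ} (G : Graph n₁) (H : Graph n₂) →
    IsSimple G → Connected G → 2 ≤ n₁ →
    IsSimple H → Connected H →
    DimAtLeast (G ⊠ H) (n₂ * (n₁ ∸ trueTwinClasses G))
corollary2 {n₁} {n₂} G H (_ , symG) connG _ (_ , symH) connH S generator =
  subst (λ r → n₂ * r ≤ ∣ S ∣) (∣nonReps∣ G)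
    (fibrewise-injections⇒≤ (nonReps G) S (λ b → select G (in-fibre? b) (twin-∈ b))
      (λ b → select-injective G (in-fibre? b) (twin-∈ b))
      (λ b → select-∈ G (in-fibre? b) (twin-∈ b)))
  where
  in-fibre? : ∀ b → Decidable (λ x → combine x b ∈ S)
  in-fibre? b x = combine x b ∈? S

  twin-∈ : ∀ b {x y} → x ≢ y → TrueTwins G x y → combine x b ∉ S → combine y b ∈ S
  twin-∈ b {x} {y} x≢y x~y =
    twin-∈-generator (G ⊠ H) (⊠-undirected G H symG symH) (⊠-connected G H connG connH)
      generator (x≢y ∘ combine-injectiveˡ x b y b) (⊠-trueTwins G H b x~y)
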